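{- Let $m$ be an odd positive integer with $m = 2n-1$, $n \ge 2$, and write $m = 2^p(2q+1) - 1$ with $p \ge 1$, $q \ge 0$. The following are equivalent: (1) $T^p(m) \equiv 0 \pmod 4$; (2) $p$ and $q$ have the same parity; (3) $C(n) = 1$.
   Context: $T:\mathbb{Z}^+\to\mathbb{Z}^+$ is defined by $T(x) = x/2$ if $x$ is even and $T(x) = (3x+1)/2$ if $x$ is odd; $T^k$ denotes the $k$-fold iterate. The function $C:\mathbb{Z}^+\to\{0,1\}$ is defined recursively by $C(1) = 0$, $C(n) = 1 - C(n-2)$ if $n > 1$ is odd, and $C(n) = 1 - C(n/2)$ if $n$ is even. -}

module Defs where

open import Data.Nat using (ℕ; zero; suc; _+_; _*_; _∸_; _/_; _%_)
open import Data.Bool using (Bool; true; false; if_then_else_)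
open import Data.Nat using (_≡ᵇ_)

even? : ℕ → Bool
even? zero = true
even? (suc zero) = false
even? (suc (suc n)) = even? n

T : ℕ → ℕ
T x = if even? x then x / 2 else (3 * x + 1) / 2

T^ : ℕ → ℕ → ℕ
T^ zero x = x
T^ (suc k) x = T^ k (T x)

-- C(1) = 0, C(n) = 1 - C(n-2) for odd n > 1, C(n) = 1 - C(n/2) for even n.
-- Implemented with a fuel argument to make termination structural;
-- fuel ≥ n suffices since each recursive call decreases n.
-- The value at 0 (outside the domain ℤ⁺) is irrelevant and set to 0.
Cf : ℕ → ℕ → ℕ
Cf zero n = 0
Cf (suc f) zero = 0
Cf (suc f) (suc zero) = 0
Cf (suc f) (suc (suc k)) =
  if even? k then 1 ∸ Cf f ((suc (suc k)) / 2) else 1 ∸ Cf f k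

C : ℕ → ℕ
C n = Cf n n

-- Since m + 1 = 2^p (2q+1), each of the p steps of T halves the even number x + 1 and
-- multiplies it by 3, so T^p(m) + 1 = 3^p (2q+1) ≡ (-1)^p (-1)^q (mod 4); hence
-- 4 ∣ T^p(m) exactly when p and q have the same parity. On the other side
-- n = 2^(p-1) (2q+1), and C flips once per halving and once per step 2q+1 ↦ 2q-1,
-- so C(n) = 1 exactly when p - 1 + q is odd.
module Submission where

open import Defs
open import Data.Nat using (ℕ; zero; suc; _+_; _*_; _∸_; _^_; _/_; _%_; _≤_; _<_; _≥_; s≤s; z≤n; NonZero)
open import Data.Nat.Properties
open import Data.Nat.DivMod using (m*n/n≡m; m/n<m; %-distribˡ-+; %-distribˡ-*; [m+n]%n≡m%n; m%n<n)
open import Data.Nat.Tactic.RingSolver using (solve-∀)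
open import Data.Bool using (Bool; true; false; not; _xor_; if_then_else_)
open import Data.Bool.Properties using (not-distribˡ-xor)
open import Data.Product using (_×_; _,_)
open import Relation.Binary.PropositionalEquality
open import Relation.Nullary using (contradiction)
open import Function.Bundles using (_⇔_; mk⇔)
open import Function.Properties.Equivalence using () renaming (sym to ⇔-sym; trans to ⇔-trans)

open ≡-Reasoning

even?-suc : ∀ n → even? (suc n) ≡ not (even? n)
even?-suc zero = refl
even?-suc (suc zero) = refl
even?-suc (suc (suc n)) = even?-suc n

even?-2* : ∀ n → even? (2 * n) ≡ true
even?-2* zero = refl
even?-2* (suc n) = trans (cong even? (*-suc 2 n)) (even?-2* n)

even?-1+2* : ∀ n → even? (1 + 2 * n) ≡ false
even?-1+2* n = trans (even?-suc (2 * n)) (cong not (even?-2* n))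

toℕ : Bool → ℕ
toℕ false = 0
toℕ true = 1

1∸toℕ : ∀ b → 1 ∸ toℕ b ≡ toℕ (not b)
1∸toℕ false = refl
1∸toℕ true = refl

toℕ-xor≡1⇔not≡ : ∀ a b → toℕ (a xor b) ≡ 1 ⇔ not a ≡ b
toℕ-xor≡1⇔not≡ true true = mk⇔ (λ ()) (λ ())
toℕ-xor≡1⇔not≡ true false = mk⇔ (λ _ → refl) (λ _ → refl)
toℕ-xor≡1⇔not≡ false true = mk⇔ (λ _ → refl) (λ _ → refl)
toℕ-xor≡1⇔not≡ false false = mk⇔ (λ ()) (λ ())

T-odd : ∀ w → T (1 + 2 * w) ≡ 2 + 3 * w
T-odd w = begin
  T (1 + 2 * w)                   ≡⟨ cong (λ b → if b then (1 + 2 * w) / 2 else (3 * (1 + 2 * w) + 1) / 2) (even?-1+2* w) ⟩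
  (3 * (1 + 2 * w) + 1) / 2       ≡⟨ cong (_/ 2) (lemma w) ⟩
  (2 + 3 * w) * 2 / 2             ≡⟨ m*n/n≡m (2 + 3 * w) 2 ⟩
  2 + 3 * w                       ∎
  where
  lemma : ∀ w → 3 * (1 + 2 * w) + 1 ≡ (2 + 3 * w) * 2
  lemma = solve-∀

T-+1≡3* : ∀ {x} y → x + 1 ≡ 2 * y → T x + 1 ≡ 3 * y
T-+1≡3* {x} (suc w) x+1≡2y = begin
  T x + 1               ≡⟨ cong (λ z → T z + 1) x≡1+2w ⟩
  T (1 + 2 * w) + 1     ≡⟨ cong (_+ 1) (T-odd w) ⟩
  2 + 3 * w + 1         ≡⟨ lemma w ⟩
  3 * suc w             ∎
  where
  x≡1+2w : x ≡ 1 + 2 * w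
  x≡1+2w = suc-injective (suc-injective (begin
    suc (suc x)     ≡⟨ cong suc (+-comm 1 x) ⟩
    suc (x + 1)     ≡⟨ cong suc x+1≡2y ⟩
    suc (2 * suc w) ≡⟨ cong suc (*-suc 2 w) ⟩
    3 + 2 * w       ∎))
  lemma : ∀ w → 2 + 3 * w + 1 ≡ 3 * suc w
  lemma = solve-∀
T-+1≡3* {x} zero x+1≡0 = contradiction (trans (+-comm 1 x) x+1≡0) 1+n≢0

T^-+1≡3^k* : ∀ k {x} c → x + 1 ≡ 2 ^ k * c → T^ k x + 1 ≡ 3 ^ k * c
T^-+1≡3^k* zero c x+1≡c = x+1≡c
T^-+1≡3^k* (suc k) {x} c x+1≡2^k*c = begin
  T^ k (T x) + 1        ≡⟨ T^-+1≡3^k* k (3 * c) Tx+1≡ ⟩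
  3 ^ k * (3 * c)       ≡⟨ lemma (3 ^ k) c ⟩
  3 ^ suc k * c         ∎
  where
  lemma : ∀ a c → a * (3 * c) ≡ 3 * a * c
  lemma = solve-∀
  swap : ∀ a c → 3 * (a * c) ≡ a * (3 * c)
  swap = solve-∀
  Tx+1≡ : T x + 1 ≡ 2 ^ k * (3 * c)
  Tx+1≡ = trans (T-+1≡3* (2 ^ k * c) (trans x+1≡2^k*c (*-assoc 2 (2 ^ k) c))) (swap (2 ^ k) c)

Cf-fuel : ∀ {f g n} → n ≤ f → n ≤ g → Cf f n ≡ Cf g n
Cf-fuel {zero} {zero} z≤n z≤n = refl
Cf-fuel {zero} {suc g} z≤n z≤n = refl
Cf-fuel {suc f} {zero} z≤n z≤n = refl
Cf-fuel {suc f} {suc g} {zero} _ _ = refl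
Cf-fuel {suc f} {suc g} {suc zero} _ _ = refl
Cf-fuel {suc f} {suc g} {suc (suc k)} (s≤s k<f) (s≤s k<g) =
  cong₂ (λ a b → if even? k then 1 ∸ a else 1 ∸ b)
    (Cf-fuel (≤-trans half≤ k<f) (≤-trans half≤ k<g))
    (Cf-fuel (<⇒≤ k<f) (<⇒≤ k<g))
  where
  half≤ : suc (suc k) / 2 ≤ suc k
  half≤ = <⇒≤pred (m/n<m (suc (suc k)) 2 (s≤s (s≤s z≤n)))

C-unfold : ∀ k → C (suc (suc k)) ≡ (if even? k then 1 ∸ C (suc (suc k) / 2) else 1 ∸ C k)
C-unfold k = cong₂ (λ a b → if even? k then 1 ∸ a else 1 ∸ b)
  (Cf-fuel (<⇒≤pred (m/n<m (suc (suc k)) 2 (s≤s (s≤s z≤n)))) ≤-refl)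
  (Cf-fuel (n≤1+n k) ≤-refl)

C-double : ∀ n .{{_ : NonZero n}} → C (2 * n) ≡ 1 ∸ C n
C-double (suc k) = begin
  C (2 * suc k)       ≡⟨ cong C (*-suc 2 k) ⟩
  C (2 + 2 * k)       ≡⟨ C-unfold (2 * k) ⟩
  (if even? (2 * k) then 1 ∸ C ((2 + 2 * k) / 2) else 1 ∸ C (2 * k))
                      ≡⟨ cong (λ b → if b then 1 ∸ C ((2 + 2 * k) / 2) else 1 ∸ C (2 * k)) (even?-2* k) ⟩
  1 ∸ C ((2 + 2 * k) / 2) ≡⟨ cong (λ x → 1 ∸ C (x / 2)) (lemma k) ⟩
  1 ∸ C (suc k * 2 / 2)   ≡⟨ cong (λ x → 1 ∸ C x) (m*n/n≡m (suc k) 2) ⟩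
  1 ∸ C (suc k)           ∎
  where
  lemma : ∀ k → 2 + 2 * k ≡ suc k * 2
  lemma = solve-∀

C-odd : ∀ q → C (1 + 2 * q) ≡ toℕ (not (even? q))
C-odd zero = refl
C-odd (suc q) = begin
  C (1 + 2 * suc q)                 ≡⟨ cong (λ x → C (suc x)) (*-suc 2 q) ⟩
  C (3 + 2 * q)                     ≡⟨ C-unfold (1 + 2 * q) ⟩
  (if even? (1 + 2 * q) then 1 ∸ C ((3 + 2 * q) / 2) else 1 ∸ C (1 + 2 * q))
                                    ≡⟨ cong (λ b → if b then 1 ∸ C ((3 + 2 * q) / 2) else 1 ∸ C (1 + 2 * q)) (even?-1+2* q) ⟩
  1 ∸ C (1 + 2 * q)                 ≡⟨ cong (1 ∸_) (C-odd q) ⟩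
  1 ∸ toℕ (not (even? q))           ≡⟨ 1∸toℕ (not (even? q)) ⟩
  toℕ (not (not (even? q)))         ≡⟨ cong (λ b → toℕ (not b)) (sym (even?-suc q)) ⟩
  toℕ (not (even? (suc q)))         ∎

C-2^k*odd : ∀ k q → C (2 ^ k * (1 + 2 * q)) ≡ toℕ (even? k xor even? q)
C-2^k*odd zero q = trans (cong C (*-identityˡ (1 + 2 * q))) (C-odd q)
C-2^k*odd (suc k) q = begin
  C (2 ^ suc k * odd)                   ≡⟨ cong C (*-assoc 2 (2 ^ k) odd) ⟩
  C (2 * (2 ^ k * odd))                 ≡⟨ C-double (2 ^ k * odd) {{m*n≢0 (2 ^ k) odd {{m^n≢0 2 k}}}} ⟩
  1 ∸ C (2 ^ k * odd)                   ≡⟨ cong (1 ∸_) (C-2^k*odd k q) ⟩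
  1 ∸ toℕ (even? k xor even? q)         ≡⟨ 1∸toℕ (even? k xor even? q) ⟩
  toℕ (not (even? k xor even? q))       ≡⟨ cong toℕ (not-distribˡ-xor (even? k) (even? q)) ⟩
  toℕ (not (even? k) xor even? q)       ≡⟨ cong (λ b → toℕ (b xor even? q)) (sym (even?-suc k)) ⟩
  toℕ (even? (suc k) xor even? q)       ∎
  where
  odd = 1 + 2 * q

-- The residue of (-1)^k modulo 4, indexed by even? k.
signMod4 : Bool → ℕ
signMod4 true = 1
signMod4 false = 3

3^k%4 : ∀ k → 3 ^ k % 4 ≡ signMod4 (even? k)
3^k%4 zero = refl
3^k%4 (suc k) = begin
  3 * 3 ^ k % 4                       ≡⟨ %-distribˡ-* 3 (3 ^ k) 4 ⟩
  3 * (3 ^ k % 4) % 4                 ≡⟨ cong (λ r → 3 * r % 4) (3^k%4 k) ⟩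
  3 * signMod4 (even? k) % 4          ≡⟨ 3*signMod4 (even? k) ⟩
  signMod4 (not (even? k))            ≡⟨ cong signMod4 (sym (even?-suc k)) ⟩
  signMod4 (even? (suc k))            ∎
  where
  3*signMod4 : ∀ b → 3 * signMod4 b % 4 ≡ signMod4 (not b)
  3*signMod4 true = refl
  3*signMod4 false = refl

1+2*q%4 : ∀ q → (1 + 2 * q) % 4 ≡ signMod4 (even? q)
1+2*q%4 zero = refl
1+2*q%4 (suc zero) = refl
1+2*q%4 (suc (suc q)) = begin
  (1 + 2 * (2 + q)) % 4     ≡⟨ cong (_% 4) (lemma q) ⟩
  (1 + 2 * q + 4) % 4       ≡⟨ [m+n]%n≡m%n (1 + 2 * q) 4 ⟩
  (1 + 2 * q) % 4           ≡⟨ 1+2*q%4 q ⟩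
  signMod4 (even? q)        ∎
  where
  lemma : ∀ q → 1 + 2 * (2 + q) ≡ 1 + 2 * q + 4
  lemma = solve-∀

signMod4-*≡1⇔≡ : ∀ a b → signMod4 a * signMod4 b % 4 ≡ 1 ⇔ a ≡ b
signMod4-*≡1⇔≡ true true = mk⇔ (λ _ → refl) (λ _ → refl)
signMod4-*≡1⇔≡ true false = mk⇔ (λ ()) (λ ())
signMod4-*≡1⇔≡ false true = mk⇔ (λ ()) (λ ())
signMod4-*≡1⇔≡ false false = mk⇔ (λ _ → refl) (λ _ → refl)

3^k*odd%4≡1⇔ : ∀ k q → 3 ^ k * (1 + 2 * q) % 4 ≡ 1 ⇔ even? k ≡ even? q
3^k*odd%4≡1⇔ k q = subst (λ r → r ≡ 1 ⇔ even? k ≡ even? q) (sym residue) (signMod4-*≡1⇔≡ (even? k) (even? q))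
  where
  residue : 3 ^ k * (1 + 2 * q) % 4 ≡ signMod4 (even? k) * signMod4 (even? q) % 4
  residue = trans (%-distribˡ-* (3 ^ k) (1 + 2 * q) 4) (cong₂ (λ a b → a * b % 4) (3^k%4 k) (1+2*q%4 q))

[x+1]%4≡1⇔x%4≡0 : ∀ x → (x + 1) % 4 ≡ 1 ⇔ x % 4 ≡ 0
[x+1]%4≡1⇔x%4≡0 x =
  subst (λ r → r ≡ 1 ⇔ x % 4 ≡ 0) (sym (%-distribˡ-+ x 1 4)) (residue (x % 4) (m%n<n x 4))
  where
  residue : ∀ r → r < 4 → (r + 1) % 4 ≡ 1 ⇔ r ≡ 0
  residue 0 _ = mk⇔ (λ _ → refl) (λ _ → refl)
  residue 1 _ = mk⇔ (λ ()) (λ ())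
  residue 2 _ = mk⇔ (λ ()) (λ ())
  residue 3 _ = mk⇔ (λ ()) (λ ())
  residue (suc (suc (suc (suc _)))) (s≤s (s≤s (s≤s (s≤s ()))))

theorem3p2 : (m n p q : ℕ) → n ≥ 2 → m + 1 ≡ 2 * n → p ≥ 1 →
    m + 1 ≡ 2 ^ p * (2 * q + 1) →
    ((T^ p m % 4 ≡ 0) ⇔ (even? p ≡ even? q))
      × ((even? p ≡ even? q) ⇔ (C n ≡ 1))
theorem3p2 m n (suc p) q _ m+1≡2n (s≤s z≤n) m+1≡2^p*[2q+1] = T-part , C-part
  where
  odd = 1 + 2 * q
  m+1≡2^p*odd : m + 1 ≡ 2 ^ suc p * odd
  m+1≡2^p*odd = trans m+1≡2^p*[2q+1] (cong (2 ^ suc p *_) (+-comm (2 * q) 1))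
  n≡2^[p-1]*odd : n ≡ 2 ^ p * odd
  n≡2^[p-1]*odd = *-cancelˡ-≡ n (2 ^ p * odd) 2
    (trans (sym m+1≡2n) (trans m+1≡2^p*odd (*-assoc 2 (2 ^ p) odd)))
  T-part : T^ (suc p) m % 4 ≡ 0 ⇔ even? (suc p) ≡ even? q
  T-part = ⇔-trans (⇔-sym ([x+1]%4≡1⇔x%4≡0 (T^ (suc p) m)))
    (subst (λ y → y % 4 ≡ 1 ⇔ even? (suc p) ≡ even? q) (sym (T^-+1≡3^k* (suc p) odd m+1≡2^p*odd)) (3^k*odd%4≡1⇔ (suc p) q))
  C-part : even? (suc p) ≡ even? q ⇔ C n ≡ 1
  C-part rewrite even?-suc p | n≡2^[p-1]*odd | C-2^k*odd p q = ⇔-sym (toℕ-xor≡1⇔not≡ (even? p) (even? q))
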